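{- Let $u<v$ be real quadratic irrationals with purely periodic continued fraction expansions, and let $i$ be an integer with $0\le i\le\textit{b-match}(u,v)$. Then $u_{(\ell(u)-i)}<v_{(\ell(v)-i)}$ if $i$ is even, and $u_{(\ell(u)-i)}>v_{(\ell(v)-i)}$ if $i$ is odd.
   Context: For a purely periodic quadratic irrational $w=[\overline{a_1;\ldots,a_\ell}]$ with $\ell=\ell(w)$ the minimal even period length, extend indices cyclically ($a_i=a_{i_0}$ if $i\equiv i_0\bmod\ell$) and set $w_{(i)}=[\overline{a_{i+1};\ldots,a_\ell,a_1,\ldots,a_i}]$ for $i\in\mathbb{Z}$. For distinct purely periodic $x,y$, write $x=[\overline{c_1;\ldots,c_N}]$, $y=[\overline{d_1;\ldots,d_N}]$ with a common even period length $N$ (repeating periods if necessary); $\textit{b-match}(x,y)=k$ means $c_N=d_N,\ldots,c_{N-k+1}=d_{N-k+1}$ and $c_{N-k}\ne d_{N-k}$. -}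

module Defs where

open import Data.Nat using (ℕ; zero; suc; _+_; _*_; _≤_; NonZero)
open import Data.Nat.Divisibility using (_∣_)
open import Data.Integer as ℤ using (ℤ; +_)
open import Data.Integer.DivMod using (_%ℕ_)
open import Data.Rational.Unnormalised using (ℚᵘ; ↥_; ↧_) renaming (_<_ to _<ℚ_)
open import Data.Product using (_×_; _,_; Σ; ∃)
open import Relation.Binary.PropositionalEquality using (_≡_)

-- An infinite continued fraction [a 0; a 1, a 2, ...] is given by its
-- sequence of partial quotients (0-based indexing: a 0 is the paper's a_1).

Periodic : (ℕ → ℕ) → ℕ → Set
Periodic a m = ∀ n → a (m + n) ≡ a n

IsMinEvenPeriod : (ℕ → ℕ) → ℕ → Set
IsMinEvenPeriod a ℓ =
  NonZero ℓ × 2 ∣ ℓ × Periodic a ℓ ×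
  (∀ m → NonZero m → 2 ∣ m → Periodic a m → ℓ ≤ m)

cyc : (ℕ → ℕ) → (ℓ : ℕ) → .{{NonZero ℓ}} → ℤ → ℕ
cyc a ℓ j = a (j %ℕ ℓ)

-- w_(j) = [a_{j+1}; a_{j+2}, ...] (paper's 1-based indices), as a sequence
wsub : (ℕ → ℕ) → (ℓ : ℕ) → .{{NonZero ℓ}} → ℤ → (ℕ → ℕ)
wsub a ℓ j n = cyc a ℓ (j ℤ.+ + n)

-- paper's 1-based entry c_t of the period of length N (cyclic in t)
entry : (ℕ → ℕ) → (N : ℕ) → .{{NonZero N}} → ℤ → ℕ
entry a N t = cyc a N (t ℤ.- + 1)

BMatch : (a b : ℕ → ℕ) (N : ℕ) → .{{NonZero N}} → ℕ → Set
BMatch a b N k =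
  (∀ j → j Data.Nat.< k → entry a N (+ N ℤ.- + j) ≡ entry b N (+ N ℤ.- + j)) ×
  (entry a N (+ N ℤ.- + k) ≡ entry b N (+ N ℤ.- + k) → Data.Empty.⊥)
  where import Data.Nat ; import Data.Empty

-- n-th convergent [a 0; a 1, ..., a n] as a pair (p , q) meaning p / q,
-- computed via [a0; rest] = a0 + 1 / [rest]
conv : (ℕ → ℕ) → ℕ → ℕ × ℕ
conv a zero = a 0 , 1
conv a (suc n) with conv (λ m → a (suc m)) n
... | p , q = a 0 * p + q , p

_≤ᶜ_ : ℕ × ℕ → ℚᵘ → Set
(p , q) ≤ᶜ r = (+ p) ℤ.* (↧ r) ℤ.≤ (↥ r) ℤ.* (+ q)

_≥ᶜ_ : ℕ × ℕ → ℚᵘ → Set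
(p , q) ≥ᶜ r = (↥ r) ℤ.* (+ q) ℤ.≤ (+ p) ℤ.* (↧ r)

-- Order of the real numbers given as limits of the convergents:
-- x < y iff there are rationals r < s with eventually conv x ≤ r and s ≤ conv y.
CFLt : (ℕ → ℕ) → (ℕ → ℕ) → Set
CFLt a b = Σ ℚᵘ λ r → Σ ℚᵘ λ s → r <ℚ s ×
  ∃ λ M → ∀ n → M ≤ n → (conv a n ≤ᶜ r) × (conv b n ≥ᶜ s)

{-# OPTIONS --safe #-}
module Submission where

-- Put A = u_(ℓ(u)-i) and B = v_(ℓ(v)-i). Dropping the first i partial quotients
-- of A and B gives back u and v, and since i ≤ b-match(u,v) these first i partial
-- quotients, the last i entries of the common period, are the same for A and B.
-- Prepending a partial quotient c applies t ↦ c + 1/t, which reverses order, so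
-- the order u < v gets reversed i times. Order is tracked through rational bounds:
-- if the convergents of x are eventually ≤ r < s ≤ those of y, then the convergents
-- of [c; y] are eventually ≤ c + 1/s < c + 1/r ≤ those of [c; x].

open import Defs
open import Data.Integer as ℤ using (+_; -[1+_]; _-_; 1ℤ; +≤+; +<+)
open import Data.Integer.DivMod using (_%ℕ_; _/ℕ_; a≡a%ℕn+[a/ℕn]*n)
open import Data.Integer.Properties using (pos-*; +-injective; drop‿+≤+; drop‿+<+; +≮-)
import Data.Integer.Tactic.RingSolver as ℤ-Ring
open import Data.Nat using (ℕ; zero; suc; _+_; _*_; _≤_; _<_; z≤n; s≤s; NonZero)
open import Data.Nat.Properties
open import Data.Nat.Divisibility using (_∣_; _∣0; ∣-refl; ∣m+n∣m⇒∣n; ∣m∣n⇒∣m+n; >⇒∤)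
import Data.Nat.Tactic.RingSolver as ℕ-Ring
open import Data.Product using (_×_; _,_; ∃; proj₁; proj₂; map)
open import Data.Rational.Unnormalised using (mkℚᵘ; *<*) renaming (_<_ to _<ℚ_)
open import Function.Bundles using (_⇔_; mk⇔; Equivalence)
open import Function using (_∘_)
open import Relation.Binary.PropositionalEquality
open import Relation.Nullary using (¬_; contradiction)

Fraction : Set
Fraction = ℕ × ℕ

infix 4 _≼_ _≺_
infixr 5 _+1/_

_≼_ : Fraction → Fraction → Set
(p , q) ≼ (r , s) = p * s ≤ r * q

_≺_ : Fraction → Fraction → Set
(p , q) ≺ (r , s) = p * s < r * q

Positive : Fraction → Set
Positive (p , q) = 0 < p × 0 < q

_+1/_ : ℕ → Fraction → Fraction
c +1/ (p , q) = c * p + q , p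

drop : ℕ → (ℕ → ℕ) → (ℕ → ℕ)
drop i x n = x (i + n)

+1/-positive : ∀ c {t} → Positive t → Positive (c +1/ t)
+1/-positive c {p , q} (0<p , 0<q) = <-≤-trans 0<q (m≤n+m q (c * p)) , 0<p

private
  cross-product : ∀ c x y z → (c * x + y) * z ≡ c * (x * z) + z * y
  cross-product = ℕ-Ring.solve-∀

+1/-antitone : ∀ {c d} t u → c ≤ d → t ≼ u → c +1/ u ≼ d +1/ t
+1/-antitone {c} {d} (t₁ , t₂) (u₁ , u₂) c≤d t≼u = begin
  (c * u₁ + u₂) * t₁       ≡⟨ cross-product c u₁ u₂ t₁ ⟩
  c * (u₁ * t₁) + t₁ * u₂  ≤⟨ +-mono-≤ (*-mono-≤ c≤d (≤-reflexive (*-comm u₁ t₁))) t≼u ⟩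
  d * (t₁ * u₁) + u₁ * t₂  ≡⟨ cross-product d t₁ t₂ u₁ ⟨
  (d * t₁ + t₂) * u₁       ∎
  where open ≤-Reasoning

+1/-antitone-strict : ∀ {c d} t u → c ≤ d → t ≺ u → c +1/ u ≺ d +1/ t
+1/-antitone-strict {c} {d} (t₁ , t₂) (u₁ , u₂) c≤d t≺u = begin-strict
  (c * u₁ + u₂) * t₁       ≡⟨ cross-product c u₁ u₂ t₁ ⟩
  c * (u₁ * t₁) + t₁ * u₂  <⟨ +-mono-≤-< (*-mono-≤ c≤d (≤-reflexive (*-comm u₁ t₁))) t≺u ⟩
  d * (t₁ * u₁) + u₁ * t₂  ≡⟨ cross-product d t₁ t₂ u₁ ⟨
  (d * t₁ + t₂) * u₁       ∎
  where open ≤-Reasoning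

conv-positive : ∀ {a} → (∀ n → 0 < a n) → ∀ n → Positive (conv a n)
conv-positive a-pos zero = a-pos 0 , s≤s z≤n
conv-positive {a} a-pos (suc n) = +1/-positive (a 0) (conv-positive (a-pos ∘ suc) n)

conv-cong : ∀ {x y} → x ≗ y → ∀ n → conv x n ≡ conv y n
conv-cong x≗y zero = cong (_, 1) (x≗y 0)
conv-cong x≗y (suc n) = cong₂ _+1/_ (x≗y 0) (conv-cong (x≗y ∘ suc) n)

Eventually : (ℕ → Set) → Set
Eventually P = ∃ λ M → ∀ n → M ≤ n → P n

eventually-map : ∀ {P Q : ℕ → Set} → (∀ {n} → P n → Q n) → Eventually P → Eventually Q
eventually-map f (M , P) = M , λ n M≤n → f (P n M≤n)

eventually-suc : ∀ {P Q : ℕ → Set} → (∀ {n} → P n → Q (suc n)) → Eventually P → Eventually Q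
eventually-suc f (M , P) = suc M , λ { (suc n) (s≤s M≤n) → f (P n M≤n) }

-- CFLt x y with positive bounds r < s given as fractions of naturals.
record Separated (x y : ℕ → ℕ) : Set where
  constructor separated
  field
    r s : Fraction
    r-positive : Positive r
    s-positive : Positive s
    r≺s : r ≺ s
    bounds : Eventually λ n → conv x n ≼ r × s ≼ conv y n

Separated-cong : ∀ {x x′ y y′} → x ≗ x′ → y ≗ y′ → Separated x y → Separated x′ y′
Separated-cong x≗x′ y≗y′ (separated r s r-pos s-pos r≺s bounds) =
  separated r s r-pos s-pos r≺s
    (eventually-map (λ {n} → map (subst (_≼ r) (conv-cong x≗x′ n)) (subst (s ≼_) (conv-cong y≗y′ n)))
      bounds)

Separated-common-head : ∀ {x y} → x 0 ≡ y 0 → Separated (drop 1 x) (drop 1 y) → Separated y x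
Separated-common-head {x} {y} x₀≡y₀ (separated r s r-pos s-pos r≺s bounds) =
  separated (x 0 +1/ s) (x 0 +1/ r) (+1/-positive (x 0) s-pos) (+1/-positive (x 0) r-pos)
    (+1/-antitone-strict r s (≤-refl {x 0}) r≺s)
    (eventually-suc (λ {n} (x≼r , s≼y) →
        +1/-antitone s (conv (drop 1 y) n) (≤-reflexive (sym x₀≡y₀)) s≼y ,
        +1/-antitone (conv (drop 1 x) n) r (≤-refl {x 0}) x≼r)
      bounds)

Flip : ∀ {A : Set} → ℕ → (A → A → Set) → A → A → Set
Flip zero R x y = R x y
Flip (suc i) R x y = Flip i R y x

Flip-parity : ∀ {A : Set} i {R : A → A → Set} {x y} → Flip i R x y → (2 ∣ i → R x y) × (¬ 2 ∣ i → R y x)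
Flip-parity zero f = (λ _ → f) , (λ 2∤0 → contradiction (2 ∣0) 2∤0)
Flip-parity (suc zero) f = (λ 2∣1 → contradiction 2∣1 (>⇒∤ (s≤s (s≤s z≤n)))) , (λ _ → f)
Flip-parity (suc (suc i)) f with Flip-parity i f
... | even , odd =
  (λ 2∣2+i → even (∣m+n∣m⇒∣n 2∣2+i ∣-refl)) ,
  (λ 2∤2+i → odd (λ 2∣i → 2∤2+i (∣m∣n⇒∣m+n ∣-refl 2∣i)))

Flip-common-head : ∀ i {x y} → x 0 ≡ y 0 → Flip i Separated (drop 1 x) (drop 1 y) → Flip (suc i) Separated x y
Flip-common-head zero = Separated-common-head
Flip-common-head (suc i) x₀≡y₀ = Flip-common-head i (sym x₀≡y₀)

Flip-common-prefix : ∀ i {x y} → (∀ m → m < i → x m ≡ y m) →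
  Separated (drop i x) (drop i y) → Flip i Separated x y
Flip-common-prefix zero _ sep = sep
Flip-common-prefix (suc i) agree sep =
  Flip-common-head i (agree 0 (s≤s z≤n)) (Flip-common-prefix i (λ m m<i → agree (suc m) (s≤s m<i)) sep)

private
  pos-*-≤-⇔ : ∀ a b c d → (+ a ℤ.* + b ℤ.≤ + c ℤ.* + d) ⇔ (a * b ≤ c * d)
  pos-*-≤-⇔ a b c d = mk⇔
    (λ h → drop‿+≤+ (subst₂ ℤ._≤_ (sym (pos-* a b)) (sym (pos-* c d)) h))
    (λ h → subst₂ ℤ._≤_ (pos-* a b) (pos-* c d) (+≤+ h))

  pos-*-<-⇔ : ∀ a b c d → (+ a ℤ.* + b ℤ.< + c ℤ.* + d) ⇔ (a * b < c * d)
  pos-*-<-⇔ a b c d = mk⇔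
    (λ h → drop‿+<+ (subst₂ ℤ._<_ (sym (pos-* a b)) (sym (pos-* c d)) h))
    (λ h → subst₂ ℤ._<_ (pos-* a b) (pos-* c d) (+<+ h))

-- A rational with non-negative numerator, mkℚᵘ (+ r₁) r₂, is the fraction (r₁ , suc r₂).
≤ᶜ⇔≼ : ∀ t r₁ r₂ → t ≤ᶜ mkℚᵘ (+ r₁) r₂ ⇔ t ≼ (r₁ , suc r₂)
≤ᶜ⇔≼ (p , q) r₁ r₂ = pos-*-≤-⇔ p (suc r₂) r₁ q

≥ᶜ⇔≽ : ∀ t s₁ s₂ → t ≥ᶜ mkℚᵘ (+ s₁) s₂ ⇔ (s₁ , suc s₂) ≼ t
≥ᶜ⇔≽ (p , q) s₁ s₂ = pos-*-≤-⇔ s₁ q p (suc s₂)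

<⇔≺ : ∀ r₁ r₂ s₁ s₂ → mkℚᵘ (+ r₁) r₂ <ℚ mkℚᵘ (+ s₁) s₂ ⇔ (r₁ , suc r₂) ≺ (s₁ , suc s₂)
<⇔≺ r₁ r₂ s₁ s₂ = mk⇔ (λ { (*<* h) → to h }) (*<* ∘ from)
  where open Equivalence (pos-*-<-⇔ r₁ (suc s₂) s₁ (suc r₂))

fromSeparated : ∀ {x y} → Separated x y → CFLt x y
fromSeparated {x} {y} (separated (r₁ , suc r₂) (s₁ , suc s₂) _ _ r≺s (M , bounds)) =
  mkℚᵘ (+ r₁) r₂ , mkℚᵘ (+ s₁) s₂ , from (<⇔≺ r₁ r₂ s₁ s₂) r≺s , M ,
  λ n M≤n → map (from (≤ᶜ⇔≼ (conv x n) r₁ r₂)) (from (≥ᶜ⇔≽ (conv y n) s₁ s₂)) (bounds n M≤n)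
  where open Equivalence

positive-≰ᶜ-negative : ∀ {t m d} → Positive t → ¬ (t ≤ᶜ mkℚᵘ -[1+ m ] d)
positive-≰ᶜ-negative {suc _ , suc _} _ ()

≼-numerator-positive : ∀ {t r₁ r₂} → Positive t → 0 < r₂ → t ≼ (r₁ , r₂) → 0 < r₁
≼-numerator-positive {suc _ , _} {zero} {suc _} _ _ ()
≼-numerator-positive {r₁ = suc _} _ _ _ = s≤s z≤n

≺-numerator-positive : ∀ {r₁ r₂ s₁ s₂} → (r₁ , r₂) ≺ (s₁ , s₂) → 0 < s₁
≺-numerator-positive {s₁ = suc _} _ = s≤s z≤n

toSeparated : ∀ {x y} → (∀ n → 0 < x n) → CFLt x y → Separated x y
toSeparated x-pos (mkℚᵘ -[1+ m ] d , _ , _ , M , bounds) =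
  contradiction (proj₁ (bounds M ≤-refl)) (positive-≰ᶜ-negative {m = m} {d} (conv-positive x-pos M))
toSeparated x-pos (mkℚᵘ (+ r₁) _ , mkℚᵘ -[1+ _ ] _ , *<* r<s , _) =
  contradiction (subst (ℤ._< _) (sym (pos-* r₁ _)) r<s) +≮-
toSeparated {x} {y} x-pos (mkℚᵘ (+ r₁) r₂ , mkℚᵘ (+ s₁) s₂ , r<s , M , bounds) =
  separated (r₁ , suc r₂) (s₁ , suc s₂)
    (≼-numerator-positive (conv-positive x-pos M) (s≤s z≤n) (x≼r M ≤-refl) , s≤s z≤n)
    (≺-numerator-positive {r₁} r≺s , s≤s z≤n) r≺s (M , λ n M≤n → x≼r n M≤n , s≼y n M≤n)
  where
  open Equivalence
  r≺s : (r₁ , suc r₂) ≺ (s₁ , suc s₂)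
  r≺s = to (<⇔≺ r₁ r₂ s₁ s₂) r<s
  x≼r : ∀ n → M ≤ n → conv x n ≼ (r₁ , suc r₂)
  x≼r n M≤n = to (≤ᶜ⇔≼ (conv x n) r₁ r₂) (proj₁ (bounds n M≤n))
  s≼y : ∀ n → M ≤ n → (s₁ , suc s₂) ≼ conv y n
  s≼y n M≤n = to (≥ᶜ⇔≽ (conv y n) s₁ s₂) (proj₂ (bounds n M≤n))

private
  swap-representation : ∀ {m n} q ℓ → m ≡ n ℤ.+ (ℤ.- q) ℤ.* ℓ → n ≡ m ℤ.+ q ℤ.* ℓ
  swap-representation {n = n} q ℓ e = trans (identity n q ℓ) (cong (ℤ._+ q ℤ.* ℓ) (sym e))
    where
    identity : ∀ n q ℓ → n ≡ (n ℤ.+ (ℤ.- q) ℤ.* ℓ) ℤ.+ q ℤ.* ℓ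
    identity = ℤ-Ring.solve-∀

  compare-representations : ∀ {z n r} q Q ℓ →
    z ≡ n ℤ.+ q ℤ.* ℓ → z ≡ r ℤ.+ Q ℤ.* ℓ → r ≡ n ℤ.+ (q - Q) ℤ.* ℓ
  compare-representations {n = n} {r} q Q ℓ z≡n+qℓ z≡r+Qℓ = begin
    r                            ≡⟨ cancel r Q ℓ ⟩
    (r ℤ.+ Q ℤ.* ℓ) - Q ℤ.* ℓ    ≡⟨ cong (_- Q ℤ.* ℓ) (trans (sym z≡r+Qℓ) z≡n+qℓ) ⟩
    (n ℤ.+ q ℤ.* ℓ) - Q ℤ.* ℓ    ≡⟨ collect n q Q ℓ ⟩
    n ℤ.+ (q - Q) ℤ.* ℓ          ∎
    where
    open ≡-Reasoning
    cancel : ∀ r Q ℓ → r ≡ (r ℤ.+ Q ℤ.* ℓ) - Q ℤ.* ℓ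
    cancel = ℤ-Ring.solve-∀
    collect : ∀ n q Q ℓ → (n ℤ.+ q ℤ.* ℓ) - Q ℤ.* ℓ ≡ n ℤ.+ (q - Q) ℤ.* ℓ
    collect = ℤ-Ring.solve-∀

module _ {a : ℕ → ℕ} {ℓ : ℕ} .{{_ : NonZero ℓ}} (periodic : Periodic a ℓ) where

  periodic-*-+ : ∀ t n → a (t * ℓ + n) ≡ a n
  periodic-*-+ zero n = refl
  periodic-*-+ (suc t) n = trans (cong a (+-assoc ℓ (t * ℓ) n)) (trans (periodic (t * ℓ + n)) (periodic-*-+ t n))

  periodic-congruent : ∀ {m n} q → + m ≡ + n ℤ.+ q ℤ.* + ℓ → a m ≡ a n
  periodic-congruent {m} {n} (+ t) m≡n+tℓ = trans (cong a m≡tℓ+n) (periodic-*-+ t n)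
    where
    m≡tℓ+n : m ≡ t * ℓ + n
    m≡tℓ+n = +-injective (trans m≡n+tℓ
      (trans (cong (λ w → + n ℤ.+ w) (sym (pos-* t ℓ))) (cong +_ (+-comm n (t * ℓ)))))
  periodic-congruent -[1+ t ] m≡n-tℓ =
    sym (periodic-congruent (+ suc t) (swap-representation (+ suc t) (+ ℓ) m≡n-tℓ))

  cyc-representative : ∀ {z n} q → z ≡ + n ℤ.+ q ℤ.* + ℓ → cyc a ℓ z ≡ a n
  cyc-representative {z} {n} q z≡n+qℓ =
    periodic-congruent (q - z /ℕ ℓ)
      (compare-representations {n = + n} q (z /ℕ ℓ) (+ ℓ) z≡n+qℓ (a≡a%ℕn+[a/ℕn]*n z ℓ))

  cyc-congruent : ∀ {z z′} q → z ≡ z′ ℤ.+ q ℤ.* + ℓ → cyc a ℓ z ≡ cyc a ℓ z′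
  cyc-congruent {z} {z′} q z≡z′+qℓ = cyc-representative (q ℤ.+ Q) (begin
    z                                  ≡⟨ z≡z′+qℓ ⟩
    z′ ℤ.+ q ℤ.* + ℓ                   ≡⟨ cong (ℤ._+ q ℤ.* + ℓ) (a≡a%ℕn+[a/ℕn]*n z′ ℓ) ⟩
    (+ r ℤ.+ Q ℤ.* + ℓ) ℤ.+ q ℤ.* + ℓ  ≡⟨ collect (+ r) Q q (+ ℓ) ⟩
    + r ℤ.+ (q ℤ.+ Q) ℤ.* + ℓ          ∎)
    where
    open ≡-Reasoning
    r = z′ %ℕ ℓ
    Q = z′ /ℕ ℓ
    collect : ∀ r Q q ℓ → (r ℤ.+ Q ℤ.* ℓ) ℤ.+ q ℤ.* ℓ ≡ r ℤ.+ (q ℤ.+ Q) ℤ.* ℓ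
    collect = ℤ-Ring.solve-∀

  drop-wsub : ∀ i → drop i (wsub a ℓ (+ ℓ - + i)) ≗ a
  drop-wsub i n = cyc-representative 1ℤ (shift (+ ℓ) (+ i) (+ n))
    where
    shift : ∀ ℓ i n → (ℓ - i) ℤ.+ (i ℤ.+ n) ≡ n ℤ.+ 1ℤ ℤ.* ℓ
    shift = ℤ-Ring.solve-∀

cyc-period-irrelevant : ∀ {a ℓ N} .{{_ : NonZero ℓ}} .{{_ : NonZero N}} →
  Periodic a ℓ → Periodic a N → ∀ z → cyc a ℓ z ≡ cyc a N z
cyc-period-irrelevant {a} {ℓ} {N} ℓ-periodic N-periodic z =
  trans (cyc-representative ℓ-periodic (Q ℤ.* + N) (trans z≡r+QℓN (regroup r Q (+ ℓ) (+ N))))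
        (sym (cyc-representative N-periodic (Q ℤ.* + ℓ) (trans z≡r+QℓN (regroup′ r Q (+ ℓ) (+ N)))))
  where
  instance _ = m*n≢0 ℓ N
  r = + (z %ℕ (ℓ * N))
  Q = z /ℕ (ℓ * N)
  z≡r+QℓN : z ≡ r ℤ.+ Q ℤ.* (+ ℓ ℤ.* + N)
  z≡r+QℓN = trans (a≡a%ℕn+[a/ℕn]*n z (ℓ * N)) (cong (λ m → r ℤ.+ Q ℤ.* m) (pos-* ℓ N))
  regroup : ∀ r Q ℓ N → r ℤ.+ Q ℤ.* (ℓ ℤ.* N) ≡ r ℤ.+ (Q ℤ.* N) ℤ.* ℓ
  regroup = ℤ-Ring.solve-∀
  regroup′ : ∀ r Q ℓ N → r ℤ.+ Q ℤ.* (ℓ ℤ.* N) ≡ r ℤ.+ (Q ℤ.* ℓ) ℤ.* N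
  regroup′ = ℤ-Ring.solve-∀

-- Both sides are the periodic extension of a at position -(1 + j).
wsub≡entry : ∀ {a ℓ N} .{{_ : NonZero ℓ}} .{{_ : NonZero N}} → Periodic a ℓ → Periodic a N →
  ∀ m j → wsub a ℓ (+ ℓ - + suc (m + j)) m ≡ entry a N (+ N - + j)
wsub≡entry {a} {ℓ} {N} ℓ-periodic N-periodic m j = begin
  cyc a ℓ ((+ ℓ - + suc (m + j)) ℤ.+ + m)
    ≡⟨ cyc-congruent ℓ-periodic {z′ = -[1+ j ]} 1ℤ (from-start (+ ℓ) (+ m) (+ j)) ⟩
  cyc a ℓ -[1+ j ]
    ≡⟨ cyc-period-irrelevant ℓ-periodic N-periodic -[1+ j ] ⟩
  cyc a N -[1+ j ]
    ≡⟨ cyc-congruent N-periodic {z′ = -[1+ j ]} 1ℤ (from-end (+ N) (+ j)) ⟨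
  cyc a N ((+ N - + j) - 1ℤ)
    ∎
  where
  open ≡-Reasoning
  from-start : ∀ ℓ m j → (ℓ - (1ℤ ℤ.+ (m ℤ.+ j))) ℤ.+ m ≡ ℤ.- (1ℤ ℤ.+ j) ℤ.+ 1ℤ ℤ.* ℓ
  from-start = ℤ-Ring.solve-∀
  from-end : ∀ N j → (N - j) - 1ℤ ≡ ℤ.- (1ℤ ℤ.+ j) ℤ.+ 1ℤ ℤ.* N
  from-end = ℤ-Ring.solve-∀

wsub-common-prefix : ∀ {a b ℓa ℓb N k} .{{_ : NonZero ℓa}} .{{_ : NonZero ℓb}} .{{_ : NonZero N}} →
  Periodic a ℓa → Periodic a N → Periodic b ℓb → Periodic b N →
  (∀ j → j < k → entry a N (+ N - + j) ≡ entry b N (+ N - + j)) →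
  ∀ {i} → i ≤ k → ∀ m → m < i → wsub a ℓa (+ ℓa - + i) m ≡ wsub b ℓb (+ ℓb - + i) m
wsub-common-prefix {a} {b} {ℓa} {ℓb} {N} a-ℓ a-N b-ℓ b-N suffix-match i≤k m m<i
  with m≤n⇒∃[o]m+o≡n m<i
... | j , refl = begin
  wsub a ℓa (+ ℓa - + suc (m + j)) m  ≡⟨ wsub≡entry a-ℓ a-N m j ⟩
  entry a N (+ N - + j)               ≡⟨ suffix-match j (≤-trans (s≤s (m≤n+m j m)) i≤k) ⟩
  entry b N (+ N - + j)               ≡⟨ wsub≡entry b-ℓ b-N m j ⟨
  wsub b ℓb (+ ℓb - + suc (m + j)) m  ∎
  where open ≡-Reasoning

lemma6p7 : (a b : ℕ → ℕ) → (∀ n → 1 ≤ a n) → (∀ n → 1 ≤ b n) →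
    (ℓa ℓb : ℕ) → {{_ : NonZero ℓa}} → {{_ : NonZero ℓb}} →
    IsMinEvenPeriod a ℓa → IsMinEvenPeriod b ℓb →
    CFLt a b →
    (N : ℕ) → {{_ : NonZero N}} → 2 ∣ N → Periodic a N → Periodic b N →
    (k : ℕ) → BMatch a b N k →
    (i : ℕ) → i ≤ k →
      (2 ∣ i → CFLt (wsub a ℓa (+ ℓa - + i)) (wsub b ℓb (+ ℓb - + i))) ×
      (¬ 2 ∣ i → CFLt (wsub b ℓb (+ ℓb - + i)) (wsub a ℓa (+ ℓa - + i)))
lemma6p7 a b a-pos _ ℓa ℓb (_ , _ , a-ℓ , _) (_ , _ , b-ℓ , _) a<b N _ a-N b-N k (suffix-match , _) i i≤k =
  map (fromSeparated ∘_) (fromSeparated ∘_) (Flip-parity i flipped)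
  where
  flipped : Flip i Separated (wsub a ℓa (+ ℓa - + i)) (wsub b ℓb (+ ℓb - + i))
  flipped = Flip-common-prefix i (wsub-common-prefix a-ℓ a-N b-ℓ b-N suffix-match i≤k)
    (Separated-cong (sym ∘ drop-wsub a-ℓ i) (sym ∘ drop-wsub b-ℓ i) (toSeparated a-pos a<b))
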